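{- The logics $\mathbf{il}^-(\mathbf{J1}^u,\mathbf{I2},\mathbf{I3})$ and $\mathbf{il}$ are deductively equivalent, i.e. they prove exactly the same $\mathcal{L}(\Box,\mathbf{I})$-formulas.
   Context: The language $\mathcal{L}(\Box,\mathbf{I})$ has propositional variables, $\bot$, $\to$, and unary modal operators $\Box$ and $\mathbf{I}$; other connectives as usual, $\Diamond A:\equiv\neg\Box\neg A$. The logic $\mathbf{il}^-$ has as axioms all tautologies of $\mathcal{L}(\Box,\mathbf{I})$, $\Box(A\to B)\to(\Box A\to\Box B)$, $\Box(\Box A\to A)\to\Box A$, and $\Box\bot\leftrightarrow\mathbf{I}\bot$; rules: Modus Ponens, Necessitation, and from $A\to B$ infer $\mathbf{I}A\to\mathbf{I}B$. Schemata: $\mathbf{I1}$: $\mathbf{I}\Box\bot$; $\mathbf{I2}$: $\Box(A\to B)\to(\mathbf{I}A\to\mathbf{I}B)$; $\mathbf{I3}$: $\mathbf{I}(A\lor\Diamond A)\to\mathbf{I}A$; $\mathbf{I4}$: $\mathbf{I}A\land\Diamond\top\to\Diamond A$; $\mathbf{J1}^u$: $\Box A\to\mathbf{I}A$. $\mathbf{il}^-(\Sigma_1,\dots,\Sigma_k)$ is $\mathbf{il}^-$ with the schemata $\Sigma_i$ added as axioms. De Rijke's logic $\mathbf{il}$ has as axioms all tautologies of $\mathcal{L}(\Box,\mathbf{I})$, $\Box(A\to B)\to(\Box A\to\Box B)$, $\Box(\Box A\to A)\to\Box A$, $\mathbf{I1}$, $\mathbf{I2}$, $\mathbf{I3}$,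 $\mathbf{I4}$, with rules Modus Ponens and Necessitation. -}

module Defs where

open import Data.Nat using (ℕ)
open import Data.Bool using (Bool; true; false; _∧_; not; _∨_)
open import Relation.Binary.PropositionalEquality using (_≡_)

infixr 5 _⇒_
data Fm : Set where
  var : ℕ → Fm
  ⊥'  : Fm
  _⇒_ : Fm → Fm → Fm
  □   : Fm → Fm
  𝐈   : Fm → Fm

¬' : Fm → Fm
¬' A = A ⇒ ⊥'

⊤' : Fm
⊤' = ¬' ⊥'

_∨'_ : Fm → Fm → Fm
A ∨' B = ¬' A ⇒ B

_∧'_ : Fm → Fm → Fm
A ∧' B = ¬' (A ⇒ ¬' B)

_⇔_ : Fm → Fm → Fm
A ⇔ B = (A ⇒ B) ∧' (B ⇒ A)

◇ : Fm → Fm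
◇ A = ¬' (□ (¬' A))

-- Propositional tautologies of L(□,I): formulas true under every Boolean
-- valuation in which variables and modalized formulas □A, 𝐈A are treated
-- as propositional atoms.
Assignment : Set
Assignment = Fm → Bool

eval : Assignment → Fm → Bool
eval a (var n) = a (var n)
eval a ⊥'      = false
eval a (A ⇒ B) = not (eval a A) ∨ eval a B
eval a (□ A)   = a (□ A)
eval a (𝐈 A)   = a (𝐈 A)

Tautology : Fm → Set
Tautology A = (a : Assignment) → eval a A ≡ true

I1 : Fm
I1 = 𝐈 (□ ⊥')

I2 : Fm → Fm → Fm
I2 A B = □ (A ⇒ B) ⇒ (𝐈 A ⇒ 𝐈 B)

I3 : Fm → Fm
I3 A = 𝐈 (A ∨' ◇ A) ⇒ 𝐈 A

I4 : Fm → Fm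
I4 A = (𝐈 A ∧' ◇ ⊤') ⇒ ◇ A

J1u : Fm → Fm
J1u A = □ A ⇒ 𝐈 A

data ⊢il⁻J1uI2I3 : Fm → Set where
  taut : ∀ {A} → Tautology A → ⊢il⁻J1uI2I3 A
  K    : ∀ A B → ⊢il⁻J1uI2I3 (□ (A ⇒ B) ⇒ (□ A ⇒ □ B))
  L    : ∀ A → ⊢il⁻J1uI2I3 (□ (□ A ⇒ A) ⇒ □ A)
  □⊥⇔𝐈⊥ : ⊢il⁻J1uI2I3 (□ ⊥' ⇔ 𝐈 ⊥')
  ax-J1u : ∀ A → ⊢il⁻J1uI2I3 (J1u A)
  ax-I2  : ∀ A B → ⊢il⁻J1uI2I3 (I2 A B)
  ax-I3  : ∀ A → ⊢il⁻J1uI2I3 (I3 A)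
  mp   : ∀ {A B} → ⊢il⁻J1uI2I3 (A ⇒ B) → ⊢il⁻J1uI2I3 A → ⊢il⁻J1uI2I3 B
  nec  : ∀ {A} → ⊢il⁻J1uI2I3 A → ⊢il⁻J1uI2I3 (□ A)
  re𝐈  : ∀ {A B} → ⊢il⁻J1uI2I3 (A ⇒ B) → ⊢il⁻J1uI2I3 (𝐈 A ⇒ 𝐈 B)

data ⊢il : Fm → Set where
  taut : ∀ {A} → Tautology A → ⊢il A
  K    : ∀ A B → ⊢il (□ (A ⇒ B) ⇒ (□ A ⇒ □ B))
  L    : ∀ A → ⊢il (□ (□ A ⇒ A) ⇒ □ A)
  ax-I1 : ⊢il I1
  ax-I2 : ∀ A B → ⊢il (I2 A B)
  ax-I3 : ∀ A → ⊢il (I3 A)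
  ax-I4 : ∀ A → ⊢il (I4 A)
  mp   : ∀ {A B} → ⊢il (A ⇒ B) → ⊢il A → ⊢il B
  nec  : ∀ {A} → ⊢il A → ⊢il (□ A)

-- In il, J1ᵘ follows from I1 and I2 (□A gives □(□⊥ → A), and I2 turns I□⊥ into IA),
-- □⊥ ↔ I⊥ follows from J1ᵘ and I4 at A = ⊥, and the rule for I is I2 after necessitation.
-- Conversely, Löb's axiom at ⊥ is the theorem □⊥ ∨ ◇□⊥; J1ᵘ puts it under I and I3
-- strips the ◇-disjunct, giving I1.  I4 is the contrapositive of I2 at ⊥ combined
-- with I⊥ → □⊥ and □⊥ → □¬⊤.
module Submission where

open import Defs
open import Data.Bool using (Bool; true; false; _∧_; not; _∨_; T)
open import Data.Bool.Properties using (T-∧; T-≡)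
open import Data.Fin using (Fin; #_)
open import Data.Nat using (ℕ; zero; suc)
open import Data.Product using (_×_; _,_; proj₁; proj₂)
open import Data.Vec using (Vec; []; _∷_; lookup; map)
open import Data.Vec.Properties using (lookup-map)
open import Function using (_∘_)
open import Function.Bundles using (Equivalence)
open import Relation.Binary.PropositionalEquality using (_≡_; refl; sym; trans; cong₂)

-- Propositional schemata over n atoms.  A schema valid by its truth table has all of its
-- substitution instances as tautologies, so propositional steps are checked by evaluation.
infixr 5 _⇒ₛ_

data Schema (n : ℕ) : Set where
  p    : Fin n → Schema n
  ⊥ₛ   : Schema n
  _⇒ₛ_ : Schema n → Schema n → Schema n

¬ₛ : ∀ {n} → Schema n → Schema n
¬ₛ φ = φ ⇒ₛ ⊥ₛ

_∧ₛ_ : ∀ {n} → Schema n → Schema n → Schema n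
φ ∧ₛ ψ = ¬ₛ (φ ⇒ₛ ¬ₛ ψ)

_⟨_⟩ : ∀ {n} → Schema n → Vec Fm n → Fm
p i      ⟨ σ ⟩ = lookup σ i
⊥ₛ       ⟨ σ ⟩ = ⊥'
(φ ⇒ₛ ψ) ⟨ σ ⟩ = φ ⟨ σ ⟩ ⇒ ψ ⟨ σ ⟩

⟦_⟧ : ∀ {n} → Schema n → Vec Bool n → Bool
⟦ p i ⟧      v = lookup v i
⟦ ⊥ₛ ⟧       v = false
⟦ φ ⇒ₛ ψ ⟧   v = not (⟦ φ ⟧ v) ∨ ⟦ ψ ⟧ v

allRows : ∀ {n} → (Vec Bool n → Bool) → Bool
allRows {zero}  f = f []
allRows {suc n} f = allRows (f ∘ (true ∷_)) ∧ allRows (f ∘ (false ∷_))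

allRows-sound : ∀ {n} (f : Vec Bool n → Bool) → T (allRows f) → ∀ v → T (f v)
allRows-sound f ok []          = ok
allRows-sound f ok (true ∷ v)  = allRows-sound (f ∘ (true ∷_))  (proj₁ (Equivalence.to T-∧ ok)) v
allRows-sound f ok (false ∷ v) = allRows-sound (f ∘ (false ∷_)) (proj₂ (Equivalence.to T-∧ ok)) v

eval-⟨⟩ : ∀ {n} (a : Assignment) (φ : Schema n) (σ : Vec Fm n) →
          eval a (φ ⟨ σ ⟩) ≡ ⟦ φ ⟧ (map (eval a) σ)
eval-⟨⟩ a (p i)    σ = sym (lookup-map i (eval a) σ)
eval-⟨⟩ a ⊥ₛ       σ = refl
eval-⟨⟩ a (φ ⇒ₛ ψ) σ = cong₂ (λ x y → not x ∨ y) (eval-⟨⟩ a φ σ) (eval-⟨⟩ a ψ σ)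

instance-tautology : ∀ {n} (φ : Schema n) {_ : T (allRows ⟦ φ ⟧)} (σ : Vec Fm n) → Tautology (φ ⟨ σ ⟩)
instance-tautology φ {valid} σ a =
  trans (eval-⟨⟩ a φ σ) (Equivalence.to T-≡ (allRows-sound ⟦ φ ⟧ valid (map (eval a) σ)))

module GLReasoning
  (⊢_  : Fm → Set)
  (taut : ∀ {A} → Tautology A → ⊢ A)
  (K    : ∀ A B → ⊢ (□ (A ⇒ B) ⇒ (□ A ⇒ □ B)))
  (L    : ∀ A → ⊢ (□ (□ A ⇒ A) ⇒ □ A))
  (mp   : ∀ {A B} → ⊢ (A ⇒ B) → ⊢ A → ⊢ B)
  (nec  : ∀ {A} → ⊢ A → ⊢ (□ A))
  where

  -- The truth-table hypothesis is a unit type once the table evaluates to true,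
  -- so it is filled in automatically.
  by-tautology : ∀ {n} (φ : Schema n) {_ : T (allRows ⟦ φ ⟧)} (σ : Vec Fm n) → ⊢ (φ ⟨ σ ⟩)
  by-tautology φ {valid} σ = taut (instance-tautology φ {valid} σ)

  ⊤-intro : ⊢ ⊤'
  ⊤-intro = by-tautology (¬ₛ ⊥ₛ) []

  weaken : ∀ A B → ⊢ (A ⇒ (B ⇒ A))
  weaken A B = by-tautology (p (# 0) ⇒ₛ p (# 1) ⇒ₛ p (# 0)) (A ∷ B ∷ [])

  ⇒-trans : ∀ {A B C} → ⊢ (A ⇒ B) → ⊢ (B ⇒ C) → ⊢ (A ⇒ C)
  ⇒-trans {A} {B} {C} ab bc = mp (mp (by-tautology
    ((p (# 0) ⇒ₛ p (# 1)) ⇒ₛ (p (# 1) ⇒ₛ p (# 2)) ⇒ₛ p (# 0) ⇒ₛ p (# 2)) (A ∷ B ∷ C ∷ [])) ab) bc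

  ⇒-discharge : ∀ {A B C} → ⊢ (A ⇒ (B ⇒ C)) → ⊢ B → ⊢ (A ⇒ C)
  ⇒-discharge {A} {B} {C} abc b = mp (mp (by-tautology
    ((p (# 0) ⇒ₛ p (# 1) ⇒ₛ p (# 2)) ⇒ₛ p (# 1) ⇒ₛ p (# 0) ⇒ₛ p (# 2)) (A ∷ B ∷ C ∷ [])) abc) b

  ∧-intro : ∀ {A B} → ⊢ A → ⊢ B → ⊢ (A ∧' B)
  ∧-intro {A} {B} a b = mp (mp (by-tautology (p (# 0) ⇒ₛ p (# 1) ⇒ₛ p (# 0) ∧ₛ p (# 1)) (A ∷ B ∷ [])) a) b

  □-mono : ∀ {A B} → ⊢ (A ⇒ B) → ⊢ (□ A ⇒ □ B)
  □-mono {A} {B} ab = mp (K A B) (nec ab)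

  -- The contrapositive of Löb's axiom at ⊥.
  □⊥-∨-◇□⊥ : ⊢ (□ ⊥' ∨' ◇ (□ ⊥'))
  □⊥-∨-◇□⊥ = mp (by-tautology ((p (# 0) ⇒ₛ p (# 1)) ⇒ₛ ¬ₛ (p (# 1)) ⇒ₛ ¬ₛ (p (# 0)))
                               (□ (¬' (□ ⊥')) ∷ □ ⊥' ∷ []))
                (L ⊥')

module IL = GLReasoning ⊢il taut K L mp nec

il-J1u : ∀ A → ⊢il (J1u A)
il-J1u A = IL.⇒-discharge (IL.⇒-trans (IL.□-mono (IL.weaken A (□ ⊥'))) (ax-I2 (□ ⊥') A)) ax-I1

il-𝐈⊥⇒□⊥ : ⊢il (𝐈 ⊥' ⇒ □ ⊥')
il-𝐈⊥⇒□⊥ =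
  mp (mp (mp (IL.by-tautology ((i ∧ₛ ¬ₛ n ⇒ₛ ¬ₛ t) ⇒ₛ t ⇒ₛ (n ⇒ₛ t ⇒ₛ b) ⇒ₛ i ⇒ₛ b)
                              (𝐈 ⊥' ∷ □ (¬' ⊤') ∷ □ ⊤' ∷ □ ⊥' ∷ []))
             (ax-I4 ⊥'))
         (nec IL.⊤-intro))
     (K ⊤' ⊥')
  where
  i n t b : Schema 4
  i = p (# 0)
  n = p (# 1)
  t = p (# 2)
  b = p (# 3)

il-□⊥⇔𝐈⊥ : ⊢il (□ ⊥' ⇔ 𝐈 ⊥')
il-□⊥⇔𝐈⊥ = IL.∧-intro (il-J1u ⊥') il-𝐈⊥⇒□⊥

il⁻J1uI2I3⊆il : ∀ {A} → ⊢il⁻J1uI2I3 A → ⊢il A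
il⁻J1uI2I3⊆il (taut t)        = taut t
il⁻J1uI2I3⊆il (K A B)         = K A B
il⁻J1uI2I3⊆il (L A)           = L A
il⁻J1uI2I3⊆il □⊥⇔𝐈⊥           = il-□⊥⇔𝐈⊥
il⁻J1uI2I3⊆il (ax-J1u A)      = il-J1u A
il⁻J1uI2I3⊆il (ax-I2 A B)     = ax-I2 A B
il⁻J1uI2I3⊆il (ax-I3 A)       = ax-I3 A
il⁻J1uI2I3⊆il (mp d e)        = mp (il⁻J1uI2I3⊆il d) (il⁻J1uI2I3⊆il e)
il⁻J1uI2I3⊆il (nec d)         = nec (il⁻J1uI2I3⊆il d)
il⁻J1uI2I3⊆il (re𝐈 {A} {B} d) = mp (ax-I2 A B) (nec (il⁻J1uI2I3⊆il d))

module IL⁻ = GLReasoning ⊢il⁻J1uI2I3 taut K L mp nec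

il⁻-I1 : ⊢il⁻J1uI2I3 I1
il⁻-I1 = mp (ax-I3 (□ ⊥')) (mp (ax-J1u (□ ⊥' ∨' ◇ (□ ⊥'))) (nec IL⁻.□⊥-∨-◇□⊥))

il⁻-I4 : ∀ A → ⊢il⁻J1uI2I3 (I4 A)
il⁻-I4 A =
  mp (mp (mp (IL⁻.by-tautology ((n ⇒ₛ i ⇒ₛ j) ⇒ₛ (d ⇒ₛ j) ∧ₛ (j ⇒ₛ d) ⇒ₛ (d ⇒ₛ m) ⇒ₛ i ∧ₛ ¬ₛ m ⇒ₛ ¬ₛ n)
                               (□ (¬' A) ∷ 𝐈 A ∷ 𝐈 ⊥' ∷ □ ⊥' ∷ □ (¬' ⊤') ∷ []))
             (ax-I2 A ⊥'))
         □⊥⇔𝐈⊥)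
     (IL⁻.□-mono (IL⁻.weaken ⊥' ⊤'))
  where
  n i j d m : Schema 5
  n = p (# 0)
  i = p (# 1)
  j = p (# 2)
  d = p (# 3)
  m = p (# 4)

il⊆il⁻J1uI2I3 : ∀ {A} → ⊢il A → ⊢il⁻J1uI2I3 A
il⊆il⁻J1uI2I3 (taut t)    = taut t
il⊆il⁻J1uI2I3 (K A B)     = K A B
il⊆il⁻J1uI2I3 (L A)       = L A
il⊆il⁻J1uI2I3 ax-I1       = il⁻-I1
il⊆il⁻J1uI2I3 (ax-I2 A B) = ax-I2 A B
il⊆il⁻J1uI2I3 (ax-I3 A)   = ax-I3 A
il⊆il⁻J1uI2I3 (ax-I4 A)   = il⁻-I4 A
il⊆il⁻J1uI2I3 (mp d e)    = mp (il⊆il⁻J1uI2I3 d) (il⊆il⁻J1uI2I3 e)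
il⊆il⁻J1uI2I3 (nec d)     = nec (il⊆il⁻J1uI2I3 d)

corollary3p9 : (A : Fm) → (⊢il⁻J1uI2I3 A → ⊢il A) × (⊢il A → ⊢il⁻J1uI2I3 A)
corollary3p9 A = il⁻J1uI2I3⊆il , il⊆il⁻J1uI2I3
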